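{- Let $(a,b,c)$ be integers with $0<a+1<b<c$ and $P_a+P_c=2P_b$. Then $$1<\frac{b-a}{c-b}<1+2^{1/3}+2^{2/3}.$$
   Context: For an integer $n$, $P_n=\frac{n(n+1)(2n+1)}{6}$ (the $n$th square pyramidal number for $n\geq 1$). -}

module Defs where

open import Data.Nat using (suc)
open import Data.Integer as ℤ using (ℤ; +_; -[1+_])
open import Data.Rational as ℚ using (ℚ; _/_)

P : ℤ → ℚ
P n = (n ℤ.* (n ℤ.+ ℤ.1ℤ) ℤ.* ((+ 2) ℤ.* n ℤ.+ ℤ.1ℤ)) / 6

-- the rational number x / y (y ≠ 0); the value at y = 0 is an irrelevant junk value 0
frac : ℤ → ℤ → ℚ
frac x (+ 0) = ℚ.0ℚ
frac x (+ suc n) = x / suc n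
frac x -[1+ n ] = (ℤ.- x) / suc n

{-# OPTIONS --safe #-}
module Submission where

-- Write b = a + x and c = b + y. Since 6 (P_{a+t} - P_a) = h(t) := 2t³ + (6a+3)t² + (6a²+6a+1)t,
-- the hypothesis says h(x + y) = 2 h(x). As h is increasing and h(2x) > 2 h(x), this forces
-- y < x; and if (x + y)³ ≤ 2x³ then also (x + y)² ≤ 2x² and x + y < 2x, so h(x + y) < 2 h(x)
-- term by term. Hence u := x + y satisfies u³ > 2x³. The rational s := 2x²/u² = 2/t² with
-- t = u/x > ∛2 lies below ∛2, i.e. s³ < 2, and the identity
--   y (u⁴ + 2x²u² + 4x⁴) - x u⁴ = (u³ - 2x³)(x² + y²)
-- shows x/y < 1 + s + s².

open import Defs
open import Relation.Binary.PropositionalEquality using (_≡_)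
open import Data.Product using (_×_; ∃-syntax)
open import Data.Integer as ℤ using (ℤ; +_)
open import Data.Rational as ℚ using (ℚ)

open import Data.Nat using (ℕ; zero; suc; NonZero; _+_; _*_; _∸_; _≤_; _<_; z<s)
open import Data.Nat.Properties
open import Data.Nat.Tactic.RingSolver using (solve-∀)
import Data.Integer.Properties as ℤ
open import Data.Rational using (_/_; 1ℚ; 0ℚ)
import Data.Rational.Properties as ℚ
open import Data.Rational.Unnormalised as ℚᵘ using (mkℚᵘ; *≡*; *<*)
import Data.Rational.Unnormalised.Properties as ℚᵘ
open import Data.Product using (_,_)
open import Relation.Binary.PropositionalEquality
  using (refl; sym; trans; cong; cong₂; subst; subst₂; module ≡-Reasoning)

m<n⇒∃[o]n≡m+1+o : ∀ {m n} → m < n → ∃[ o ] n ≡ m + suc o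
m<n⇒∃[o]n≡m+1+o {m} m<n =
  let o , 1+m+o≡n = m≤n⇒∃[o]m+o≡n m<n in o , trans (sym 1+m+o≡n) (sym (+-suc m o))

+[m+n]-+m≡+n : ∀ m n → + (m + n) ℤ.- + m ≡ + n
+[m+n]-+m≡+n m n = begin
  + (m + n) ℤ.- + m  ≡⟨ ℤ.m-n≡m⊖n (m + n) m ⟩
  (m + n) ℤ.⊖ m      ≡⟨ ℤ.⊖-≥ (m≤m+n m n) ⟩
  + (m + n ∸ m)      ≡⟨ cong +_ (m+n∸m≡n m n) ⟩
  + n                ∎
  where open ≡-Reasoning

square<⇒cube< : ∀ k x u .{{_ : NonZero k}} → k * (x * x) < u * u → k * (x * x * x) < u * u * u
square<⇒cube< k x u@(suc _) kx²<u² = begin-strict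
  k * (x * x * x)   ≡⟨ reassociate k x ⟩
  x * (k * (x * x)) ≤⟨ *-monoˡ-≤ (k * (x * x)) x≤u ⟩
  u * (k * (x * x)) <⟨ *-monoʳ-< u kx²<u² ⟩
  u * (u * u)       ≡⟨ *-assoc u u u ⟨
  u * u * u         ∎
  where
  open ≤-Reasoning
  reassociate : ∀ k x → k * (x * x * x) ≡ x * (k * (x * x))
  reassociate = solve-∀
  x≤u : x ≤ u
  x≤u = ≮⇒≥ λ u<x → <⇒≱ kx²<u² (≤-trans (*-mono-≤ (<⇒≤ u<x) (<⇒≤ u<x)) (m≤n*m (x * x) k))

cube≤double⇒square≤double : ∀ u x → u * u * u ≤ 2 * (x * x * x) → u * u ≤ 2 * (x * x)
cube≤double⇒square≤double u x u³≤2x³ =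
  ≮⇒≥ λ 2x²<u² → <⇒≱ (square<⇒cube< 2 x u 2x²<u²) u³≤2x³

toℚᵘ-/ : ∀ i n .{{_ : NonZero n}} → ℚ.toℚᵘ (i / n) ℚᵘ.≃ (i ℚᵘ./ n)
toℚᵘ-/ i (suc n) = ℚ.toℚᵘ-fromℚᵘ (mkℚᵘ i n)

/-≡-/ : ∀ m b n d .{{_ : NonZero b}} .{{_ : NonZero d}} → m * d ≡ n * b → + m / b ≡ + n / d
/-≡-/ m b@(suc _) n d@(suc _) eq = ℚ.toℚᵘ-injective (begin-equality
  ℚ.toℚᵘ (+ m / b) ≃⟨ toℚᵘ-/ (+ m) b ⟩
  + m ℚᵘ./ b       ≃⟨ *≡* (trans (sym (ℤ.pos-* m d)) (trans (cong +_ eq) (ℤ.pos-* n b))) ⟩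
  + n ℚᵘ./ d       ≃⟨ toℚᵘ-/ (+ n) d ⟨
  ℚ.toℚᵘ (+ n / d) ∎)
  where open ℚᵘ.≤-Reasoning

/-≡-/⁻¹ : ∀ m b n d .{{_ : NonZero b}} .{{_ : NonZero d}} → + m / b ≡ + n / d → m * d ≡ n * b
/-≡-/⁻¹ m b@(suc _) n d@(suc _) eq with *≡* e ← ℚᵘ.≃-trans (ℚᵘ.≃-sym (toℚᵘ-/ (+ m) b))
                                             (ℚᵘ.≃-trans (ℚ.toℚᵘ-cong eq) (toℚᵘ-/ (+ n) d))
  = ℤ.+-injective (trans (ℤ.pos-* m d) (trans e (sym (ℤ.pos-* n b))))

/-<-/ : ∀ m b n d .{{_ : NonZero b}} .{{_ : NonZero d}} → m * d < n * b → + m / b ℚ.< + n / d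
/-<-/ m b@(suc _) n d@(suc _) lt = ℚ.toℚᵘ-cancel-<
  (ℚᵘ.<-respˡ-≃ (ℚᵘ.≃-sym (toℚᵘ-/ (+ m) b)) (ℚᵘ.<-respʳ-≃ (ℚᵘ.≃-sym (toℚᵘ-/ (+ n) d))
    (*<* (subst₂ ℤ._<_ (ℤ.pos-* m d) (ℤ.pos-* n b) (ℤ.+<+ lt)))))

/-+-/ : ∀ m b n d .{{_ : NonZero b}} .{{_ : NonZero d}} .{{_ : NonZero (b * d)}} →
  + m / b ℚ.+ + n / d ≡ + (m * d + n * b) / (b * d)
/-+-/ m b@(suc _) n d@(suc _) = ℚ.toℚᵘ-injective (begin-equality
  ℚ.toℚᵘ (+ m / b ℚ.+ + n / d)
    ≃⟨ ℚ.toℚᵘ-homo-+ (+ m / b) (+ n / d) ⟩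
  ℚ.toℚᵘ (+ m / b) ℚᵘ.+ ℚ.toℚᵘ (+ n / d)
    ≃⟨ ℚᵘ.+-cong (toℚᵘ-/ (+ m) b) (toℚᵘ-/ (+ n) d) ⟩
  (+ m ℚᵘ./ b) ℚᵘ.+ (+ n ℚᵘ./ d)
    ≡⟨ cong (ℚᵘ._/ (b * d)) (sym (cong₂ ℤ._+_ (ℤ.pos-* m d) (ℤ.pos-* n b))) ⟩
  + (m * d + n * b) ℚᵘ./ (b * d)
    ≃⟨ toℚᵘ-/ (+ (m * d + n * b)) (b * d) ⟨
  ℚ.toℚᵘ (+ (m * d + n * b) / (b * d))
    ∎)
  where open ℚᵘ.≤-Reasoning

/-*-/ : ∀ m b n d .{{_ : NonZero b}} .{{_ : NonZero d}} .{{_ : NonZero (b * d)}} →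
  (+ m / b) ℚ.* (+ n / d) ≡ + (m * n) / (b * d)
/-*-/ m b@(suc _) n d@(suc _) = ℚ.toℚᵘ-injective (begin-equality
  ℚ.toℚᵘ ((+ m / b) ℚ.* (+ n / d))        ≃⟨ ℚ.toℚᵘ-homo-* (+ m / b) (+ n / d) ⟩
  ℚ.toℚᵘ (+ m / b) ℚᵘ.* ℚ.toℚᵘ (+ n / d)  ≃⟨ ℚᵘ.*-cong (toℚᵘ-/ (+ m) b) (toℚᵘ-/ (+ n) d) ⟩
  (+ m ℚᵘ./ b) ℚᵘ.* (+ n ℚᵘ./ d)           ≡⟨ cong (ℚᵘ._/ (b * d)) (sym (ℤ.pos-* m n)) ⟩
  + (m * n) ℚᵘ./ (b * d)                   ≃⟨ toℚᵘ-/ (+ (m * n)) (b * d) ⟨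
  ℚ.toℚᵘ (+ (m * n) / (b * d))             ∎)
  where open ℚᵘ.≤-Reasoning

module _ (R Q : ℕ) where

  cubic : ℕ → ℕ
  cubic t = 2 * (t * t * t) + R * (t * t) + Q * t

  cubic-mono-≤ : ∀ {u v} → u ≤ v → cubic u ≤ cubic v
  cubic-mono-≤ u≤v =
    +-mono-≤ (+-mono-≤ (*-monoʳ-≤ 2 (*-mono-≤ u²≤v² u≤v)) (*-monoʳ-≤ R u²≤v²)) (*-monoʳ-≤ Q u≤v)
    where u²≤v² = *-mono-≤ u≤v u≤v

  double-cubic<cubic-double : ∀ x .{{_ : NonZero x}} → 2 * cubic x < cubic (2 * x)
  double-cubic<cubic-double x@(suc _) =
    subst (2 * cubic x <_) (sym (expand R Q x)) (m<m+n (2 * cubic x) z<s)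
    where
    expand : ∀ R Q x → 2 * ((2 * x) * (2 * x) * (2 * x)) + R * ((2 * x) * (2 * x)) + Q * (2 * x)
      ≡ 2 * (2 * (x * x * x) + R * (x * x) + Q * x) + (12 * (x * x * x) + 2 * R * (x * x))
    expand = solve-∀

  cubic-balance⇒<double : ∀ u x .{{_ : NonZero x}} → cubic u ≡ 2 * cubic x → u < 2 * x
  cubic-balance⇒<double u x eq = ≰⇒> λ 2x≤u →
    <⇒≱ (double-cubic<cubic-double x) (subst (cubic (2 * x) ≤_) eq (cubic-mono-≤ 2x≤u))

  cubic<double : ∀ u x .{{_ : NonZero Q}} →
    u * u * u ≤ 2 * (x * x * x) → u * u ≤ 2 * (x * x) → u < 2 * x → cubic u < 2 * cubic x
  cubic<double u x u³≤2x³ u²≤2x² u<2x = begin-strict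
    cubic u
      <⟨ +-mono-≤-< (+-mono-≤ (*-monoʳ-≤ 2 u³≤2x³) (*-monoʳ-≤ R u²≤2x²)) (*-monoʳ-< Q u<2x) ⟩
    2 * (2 * (x * x * x)) + R * (2 * (x * x)) + Q * (2 * x)
      ≡⟨ distribute R Q x ⟩
    2 * cubic x
      ∎
    where
    open ≤-Reasoning
    distribute : ∀ R Q x → 2 * (2 * (x * x * x)) + R * (2 * (x * x)) + Q * (2 * x)
      ≡ 2 * (2 * (x * x * x) + R * (x * x) + Q * x)
    distribute = solve-∀

  cubic-balance⇒double-cube<cube : ∀ u x .{{_ : NonZero Q}} .{{_ : NonZero x}} →
    cubic u ≡ 2 * cubic x → 2 * (x * x * x) < u * u * u
  cubic-balance⇒double-cube<cube u x eq = ≰⇒> λ u³≤2x³ →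
    <-irrefl eq (cubic<double u x u³≤2x³ (cube≤double⇒square≤double u x u³≤2x³)
                                         (cubic-balance⇒<double u x eq))

sixP : ℕ → ℕ
sixP n = n * (n + 1) * (2 * n + 1)

sixP-increment : ℕ → ℕ → ℕ
sixP-increment A = cubic (3 + 6 * A) (1 + 6 * A + 6 * (A * A))

sixP-+ : ∀ A t → sixP (A + t) ≡ sixP A + sixP-increment A t
sixP-+ = expand
  where
  expand : ∀ A t → (A + t) * (A + t + 1) * (2 * (A + t) + 1) ≡ A * (A + 1) * (2 * A + 1) +
    (2 * (t * t * t) + (3 + 6 * A) * (t * t) + (1 + 6 * A + 6 * (A * A)) * t)
  expand = solve-∀

sixP-balance⇒increment-balance : ∀ A x u →
  sixP A + sixP (A + u) ≡ sixP (A + x) + sixP (A + x) → sixP-increment A u ≡ 2 * sixP-increment A x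
sixP-balance⇒increment-balance A x u eq = +-cancelˡ-≡ (2 * sixP A) _ _ (begin
  2 * sixP A + sixP-increment A u
    ≡⟨ regroupˡ (sixP A) (sixP-increment A u) ⟩
  sixP A + (sixP A + sixP-increment A u)
    ≡⟨ cong (λ n → sixP A + n) (sixP-+ A u) ⟨
  sixP A + sixP (A + u)
    ≡⟨ eq ⟩
  sixP (A + x) + sixP (A + x)
    ≡⟨ cong₂ _+_ (sixP-+ A x) (sixP-+ A x) ⟩
  (sixP A + sixP-increment A x) + (sixP A + sixP-increment A x)
    ≡⟨ regroupʳ (sixP A) (sixP-increment A x) ⟩
  2 * sixP A + 2 * sixP-increment A x
    ∎)
  where
  open ≡-Reasoning
  regroupˡ : ∀ p c → 2 * p + c ≡ p + (p + c)
  regroupˡ = solve-∀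
  regroupʳ : ∀ p c → (p + c) + (p + c) ≡ 2 * p + 2 * c
  regroupʳ = solve-∀

sixP-balance⇒y<x∧2x³<[x+y]³ : ∀ A x y .{{_ : NonZero x}} →
  sixP A + sixP (A + x + y) ≡ sixP (A + x) + sixP (A + x) →
  y < x × 2 * (x * x * x) < (x + y) * (x + y) * (x + y)
sixP-balance⇒y<x∧2x³<[x+y]³ A x y eq =
  +-cancelˡ-< x y x (subst (x + y <_) (2*m≡m+m x) (cubic-balance⇒<double R Q (x + y) x balance)) ,
  cubic-balance⇒double-cube<cube R Q (x + y) x balance
  where
  R = 3 + 6 * A
  Q = 1 + 6 * A + 6 * (A * A)
  balance : cubic R Q (x + y) ≡ 2 * cubic R Q x
  balance = sixP-balance⇒increment-balance A x (x + y)
    (subst (λ c → sixP A + sixP c ≡ sixP (A + x) + sixP (A + x)) (+-assoc A x y) eq)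
  2*m≡m+m : ∀ m → 2 * m ≡ m + m
  2*m≡m+m = solve-∀

P≡sixP/6 : ∀ n → P (+ n) ≡ + sixP n / 6
P≡sixP/6 n = cong (_/ 6) (begin
  + n ℤ.* (+ n ℤ.+ ℤ.1ℤ) ℤ.* (+ 2 ℤ.* + n ℤ.+ ℤ.1ℤ)
    ≡⟨ cong (λ k → + n ℤ.* + (n + 1) ℤ.* (k ℤ.+ ℤ.1ℤ)) (ℤ.pos-* 2 n) ⟨
  + n ℤ.* + (n + 1) ℤ.* + (2 * n + 1)
    ≡⟨ cong (ℤ._* + (2 * n + 1)) (ℤ.pos-* n (n + 1)) ⟨
  + (n * (n + 1)) ℤ.* + (2 * n + 1)
    ≡⟨ ℤ.pos-* (n * (n + 1)) (2 * n + 1) ⟨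
  + sixP n
    ∎)
  where open ≡-Reasoning

P-balance⇒sixP-balance : ∀ A B C →
  P (+ A) ℚ.+ P (+ C) ≡ P (+ B) ℚ.+ P (+ B) → sixP A + sixP C ≡ sixP B + sixP B
P-balance⇒sixP-balance A B C eq = *-cancelʳ-≡ _ _ 216 (begin
  (a + c) * 216
    ≡⟨ scale a c ⟩
  (a * 6 + c * 6) * (6 * 6)
    ≡⟨ /-≡-/⁻¹ (a * 6 + c * 6) (6 * 6) (b * 6 + b * 6) (6 * 6) sixP-balance/36 ⟩
  (b * 6 + b * 6) * (6 * 6)
    ≡⟨ scale b b ⟨
  (b + b) * 216
    ∎)
  where
  open ≡-Reasoning
  a = sixP A
  b = sixP B
  c = sixP C
  scale : ∀ a c → (a + c) * 216 ≡ (a * 6 + c * 6) * (6 * 6)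
  scale = solve-∀
  sixP-balance/36 : + (a * 6 + c * 6) / (6 * 6) ≡ + (b * 6 + b * 6) / (6 * 6)
  sixP-balance/36 = begin
    + (a * 6 + c * 6) / (6 * 6) ≡⟨ /-+-/ a 6 c 6 ⟨
    + a / 6 ℚ.+ + c / 6         ≡⟨ cong₂ ℚ._+_ (P≡sixP/6 A) (P≡sixP/6 C) ⟨
    P (+ A) ℚ.+ P (+ C)         ≡⟨ eq ⟩
    P (+ B) ℚ.+ P (+ B)         ≡⟨ cong₂ ℚ._+_ (P≡sixP/6 B) (P≡sixP/6 B) ⟩
    + b / 6 ℚ.+ + b / 6         ≡⟨ /-+-/ b 6 b 6 ⟩
    + (b * 6 + b * 6) / (6 * 6) ∎

double-cube<cube⇒[2x²]³<2[u²]³ : ∀ x u → 2 * (x * x * x) < u * u * u →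
  2 * (x * x) * (2 * (x * x)) * (2 * (x * x)) * 1 < 2 * (u * u * (u * u) * (u * u))
double-cube<cube⇒[2x²]³<2[u²]³ x u gap = begin-strict
  2 * (x * x) * (2 * (x * x)) * (2 * (x * x)) * 1 ≡⟨ regroupˡ x ⟩
  2 * (2 * (x * x * x) * (2 * (x * x * x)))        <⟨ *-monoʳ-< 2 (*-mono-< gap gap) ⟩
  2 * (u * u * u * (u * u * u))                    ≡⟨ regroupʳ u ⟩
  2 * (u * u * (u * u) * (u * u))                  ∎
  where
  open ≤-Reasoning
  regroupˡ : ∀ x →
    2 * (x * x) * (2 * (x * x)) * (2 * (x * x)) * 1 ≡ 2 * (2 * (x * x * x) * (2 * (x * x * x)))
  regroupˡ = solve-∀
  regroupʳ : ∀ u → 2 * (u * u * u * (u * u * u)) ≡ 2 * (u * u * (u * u) * (u * u))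
  regroupʳ = solve-∀

double-cube<cube⇒ratio-bound : ∀ x y .{{_ : NonZero y}} → let u = x + y in
  2 * (x * x * x) < u * u * u →
  x * (u * u * (u * u))
    < (u * u * (u * u) + 2 * (x * x) * (u * u) + 2 * (x * x) * (2 * (x * x))) * y
double-cube<cube⇒ratio-bound x y@(suc _) gap = +-cancelʳ-< (u * u * u * w) _ _ (begin-strict
  x * (u * u * (u * u)) + u * u * u * w   ≡⟨ factorisation x y ⟨
  N * y + 2 * (x * x * x) * w             <⟨ +-monoʳ-< (N * y) (*-monoˡ-< w gap) ⟩
  N * y + u * u * u * w                   ∎)
  where
  open ≤-Reasoning
  u = x + y
  w = y * y + x * x
  N = u * u * (u * u) + 2 * (x * x) * (u * u) + 2 * (x * x) * (2 * (x * x))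
  factorisation : ∀ x y → let u = x + y in
    (u * u * (u * u) + 2 * (x * x) * (u * u) + 2 * (x * x) * (2 * (x * x))) * y
      + 2 * (x * x * x) * (y * y + x * x)
    ≡ x * (u * u * (u * u)) + u * u * u * (y * y + x * x)
  factorisation = solve-∀

1+q+q²-/ : ∀ m d .{{_ : NonZero d}} .{{_ : NonZero (d * d)}} → let q = + m / d in
  1ℚ ℚ.+ q ℚ.+ q ℚ.* q ≡ + (d * d + m * d + m * m) / (d * d)
1+q+q²-/ m d@(suc _) = begin
  1ℚ ℚ.+ + m / d ℚ.+ (+ m / d) ℚ.* (+ m / d)
    ≡⟨ cong₂ ℚ._+_ (/-+-/ 1 1 m d) (/-*-/ m d m d) ⟩
  + (1 * d + m * 1) / (1 * d) ℚ.+ + (m * m) / (d * d)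
    ≡⟨ /-+-/ (1 * d + m * 1) (1 * d) (m * m) (d * d) ⟩
  + ((1 * d + m * 1) * (d * d) + m * m * (1 * d)) / (1 * d * (d * d))
    ≡⟨ /-≡-/ ((1 * d + m * 1) * (d * d) + m * m * (1 * d)) (1 * d * (d * d))
               (d * d + m * d + m * m) (d * d) (cross-multiplied m d) ⟩
  + (d * d + m * d + m * m) / (d * d)
    ∎
  where
  open ≡-Reasoning
  cross-multiplied : ∀ m d → ((1 * d + m * 1) * (d * d) + m * m * (1 * d)) * (d * d)
    ≡ (d * d + m * d + m * m) * (1 * d * (d * d))
  cross-multiplied = solve-∀

q³-/ : ∀ m d .{{_ : NonZero d}} .{{_ : NonZero (d * d)}} .{{_ : NonZero (d * d * d)}} →
  let q = + m / d in q ℚ.* q ℚ.* q ≡ + (m * m * m) / (d * d * d)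
q³-/ m d@(suc _) = trans (cong (ℚ._* (+ m / d)) (/-*-/ m d m d)) (/-*-/ (m * m) (d * d) m d)

double-cube<cube⇒x/y<1+∛2+∛4 : ∀ x y .{{_ : NonZero x}} .{{_ : NonZero y}} →
  2 * (x * x * x) < (x + y) * (x + y) * (x + y) →
  ∃[ s ] (0ℚ ℚ.≤ s × s ℚ.* s ℚ.* s ℚ.< 1ℚ ℚ.+ 1ℚ × + x / y ℚ.< 1ℚ ℚ.+ s ℚ.+ s ℚ.* s)
double-cube<cube⇒x/y<1+∛2+∛4 x@(suc _) y@(suc _) gap =
  s , ℚ.nonNegative⁻¹ s {{ℚ.normalize-nonNeg m d}} , s³<2 , x/y<1+s+s²
  where
  open ℚ.≤-Reasoning
  u = x + y
  m = 2 * (x * x)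
  d = u * u
  s = + m / d
  s³<2 : s ℚ.* s ℚ.* s ℚ.< 1ℚ ℚ.+ 1ℚ
  s³<2 = begin-strict
    s ℚ.* s ℚ.* s
      ≡⟨ q³-/ m d ⟩
    + (m * m * m) / (d * d * d)
      <⟨ /-<-/ (m * m * m) (d * d * d) 2 1 (double-cube<cube⇒[2x²]³<2[u²]³ x u gap) ⟩
    1ℚ ℚ.+ 1ℚ
      ∎
  x/y<1+s+s² : + x / y ℚ.< 1ℚ ℚ.+ s ℚ.+ s ℚ.* s
  x/y<1+s+s² = begin-strict
    + x / y
      <⟨ /-<-/ x y (d * d + m * d + m * m) (d * d) (double-cube<cube⇒ratio-bound x y gap) ⟩
    + (d * d + m * d + m * m) / (d * d)
      ≡⟨ 1+q+q²-/ m d ⟨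
    1ℚ ℚ.+ s ℚ.+ s ℚ.* s
      ∎

lemma2p2 : (a b c : ℤ) → + 0 ℤ.< a ℤ.+ ℤ.1ℤ → a ℤ.+ ℤ.1ℤ ℤ.< b → b ℤ.< c →
    P a ℚ.+ P c ≡ P b ℚ.+ P b →
    (ℚ.1ℚ ℚ.< frac (b ℤ.- a) (c ℤ.- b))
      × (∃[ s ] (ℚ.0ℚ ℚ.≤ s × s ℚ.* s ℚ.* s ℚ.< ℚ.1ℚ ℚ.+ ℚ.1ℚ
                  × frac (b ℤ.- a) (c ℤ.- b) ℚ.< ℚ.1ℚ ℚ.+ s ℚ.+ s ℚ.* s))
lemma2p2 (+ A) (+ B) (+ C) _ (ℤ.+<+ A+1<B) (ℤ.+<+ B<C) eq
  with x-1 , refl ← m<n⇒∃[o]n≡m+1+o (<-trans (m<m+n A z<s) A+1<B)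
  with y-1 , refl ← m<n⇒∃[o]n≡m+1+o B<C
  rewrite +[m+n]-+m≡+n A (suc x-1) | +[m+n]-+m≡+n (A + suc x-1) (suc y-1)
  = let y<x , gap = sixP-balance⇒y<x∧2x³<[x+y]³ A x y
                      (P-balance⇒sixP-balance A (A + x) (A + x + y) eq)
    in /-<-/ 1 1 x y (subst₂ _<_ (sym (*-identityˡ y)) (sym (*-identityʳ x)) y<x) ,
       double-cube<cube⇒x/y<1+∛2+∛4 x y gap
  where
  x = suc x-1
  y = suc y-1
lemma2p2 (+ _) ℤ.-[1+ _ ] _ _ () _ _
lemma2p2 (+ _) (+ _) ℤ.-[1+ _ ] _ _ () _
lemma2p2 ℤ.-[1+ zero ] _ _ (ℤ.+<+ ()) _ _ _
lemma2p2 ℤ.-[1+ suc _ ] _ _ () _ _ _
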